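{- Let $k\ge 1$, $n\ge 1$ and $i$ be integers, let $\varepsilon$ be a real number, and let $\mathcal{F}\subseteq \bigcup_{j=i}^{i+k-1} \binom{[n]}{j}$ be a family with $\lambda_n(\mathcal{F})\ge k-1+\varepsilon$. Then the number of maximal chains in $2^{[n]}$ containing exactly $k$ members of $\mathcal{F}$ is at least $(\varepsilon/k)\,n!$.
   Context: $\binom{[n]}{j}$ denotes the family of $j$-element subsets of $[n]=\{1,\dots,n\}$. A maximal chain in $2^{[n]}$ is a chain $\emptyset=C_0\subset C_1\subset\dots\subset C_n=[n]$ with $|C_j|=j$; there are $n!$ of them. The Lubell function of $\mathcal{F}\subseteq 2^{[n]}$ is $\lambda_n(\mathcal{F})=\sum_{F\in\mathcal{F}}\binom{n}{|F|}^{ -1}$, the average number of members of $\mathcal{F}$ on a maximal chain.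
   Formalization: The parameter ε ranges over the rationals instead of the real numbers. -}

module Defs where

open import Data.Nat using (ℕ; zero; suc)
open import Data.Nat.Combinatorics using (_C_)
open import Data.Integer using (ℤ; +_)
open import Data.Rational using (ℚ; _/_; 0ℚ; _+_)
open import Data.Fin using (Fin; suc; inject₁; toℕ)
open import Data.Fin.Subset using (Subset; ∣_∣; _⊆_)
open import Data.Bool.Properties using () renaming (_≟_ to _≟ᵇ_)
open import Data.Vec using (Vec; lookup; count)
open import Data.Vec.Properties using (≡-dec)
open import Data.List using (List; []; _∷_)
import Data.List.Membership.DecPropositional as DecMem
open import Relation.Binary.PropositionalEquality using (_≡_)
open import Data.Product using (_×_)

ℕ→ℚ : ℕ → ℚ
ℕ→ℚ m = (+ m) / 1

-- 1/m as a rational (the m = 0 case never arises below: binom(n,|F|) ≥ 1)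
inv : ℕ → ℚ
inv zero = 0ℚ
inv (suc m) = (+ 1) / suc m

lubell : (n : ℕ) → List (Subset n) → ℚ
lubell n [] = 0ℚ
lubell n (S ∷ 𝓕) = inv (n C ∣ S ∣) + lubell n 𝓕

IsMaxChain : (n : ℕ) → Vec (Subset n) (suc n) → Set
IsMaxChain n ch =
  ((j : Fin (suc n)) → ∣ lookup ch j ∣ ≡ toℕ j) ×
  ((j : Fin n) → lookup ch (inject₁ j) ⊆ lookup ch (suc j))

membersOn : {n : ℕ} → List (Subset n) → Vec (Subset n) (suc n) → ℕ
membersOn {n} 𝓕 ch = count (λ S → S ∈? 𝓕) ch
  where open DecMem (≡-dec {n = n} _≟ᵇ_) using (_∈?_)

module Submission where

-- Maximal chains of 2^[n+1] arise uniquely from those of 2^[n] by choosing the step at which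
-- the new point enters; following a set F through this recursion shows that at least
-- |F|! (n - |F|)! chains pass through F, so Σ_C |𝓕 ∩ C| ≥ λ_n(𝓕) n! ≥ (k - 1 + ε) n!.
-- A chain meets each level once and 𝓕 lies in k consecutive levels, so |𝓕 ∩ C| ≤ k and
-- Σ_C |𝓕 ∩ C| ≤ (k - 1) n! + #{C : |𝓕 ∩ C| = k}.  Hence at least ε n! chains carry
-- exactly k members of 𝓕, and ε n! ≥ (ε/k) n! when ε ≥ 0 (the claim is trivial otherwise).

open import Relation.Binary.Definitions using (DecidableEquality)

module Sums where
  open import Data.Nat using (ℕ; zero; suc; _+_; _*_; _∸_; _≤_; _<_; z≤n; s≤s)
  open import Data.Nat.Properties
  open import Data.Nat.Tactic.RingSolver using (solve-∀)
  open import Algebra.Properties.CommutativeSemigroup +-commutativeSemigroup using (interchange)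
  open import Data.Fin using (Fin; zero; suc; toℕ)
  open import Data.List using (List; []; _∷_; _++_; map; length; filter; cartesianProductWith; tabulate; allFin)
  open import Data.List.Relation.Unary.All using (All; []; _∷_)
  open import Data.Vec using (Vec; []; _∷_; count)
  open import Function using (_∘_)
  open import Relation.Nullary using (Dec; yes; no; contradiction)
  open import Relation.Unary using (Decidable)
  open import Relation.Binary.PropositionalEquality

  ∑ : {A : Set} → List A → (A → ℕ) → ℕ
  ∑ []       f = 0
  ∑ (x ∷ xs) f = f x + ∑ xs f

  syntax ∑ xs (λ x → e) = ∑[ x ∈ xs ] e

  χ : {P : Set} → Dec P → ℕ
  χ (yes _) = 1
  χ (no _)  = 0

  χ-yes : {P : Set} (P? : Dec P) → P → 1 ≤ χ P?
  χ-yes (yes _) _  = ≤-refl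
  χ-yes (no ¬p) p  = contradiction p ¬p

  χ-mono : {P Q : Set} → (P → Q) → (P? : Dec P) (Q? : Dec Q) → χ P? ≤ χ Q?
  χ-mono P⇒Q (yes p) Q? = χ-yes Q? (P⇒Q p)
  χ-mono P⇒Q (no _)  Q? = z≤n

  count-∷ : ∀ {A : Set} {P : A → Set} (P? : Decidable P) x {m} (xs : Vec A m) →
            count P? (x ∷ xs) ≡ χ (P? x) + count P? xs
  count-∷ P? x xs with P? x
  ... | yes _ = refl
  ... | no _  = refl

  private variable A B C : Set

  ∑-++ : ∀ xs ys (f : A → ℕ) → ∑ (xs ++ ys) f ≡ ∑ xs f + ∑ ys f
  ∑-++ []       ys f = refl
  ∑-++ (x ∷ xs) ys f = trans (cong (f x +_) (∑-++ xs ys f)) (sym (+-assoc (f x) _ _))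

  ∑-map : ∀ (g : A → B) xs (f : B → ℕ) → ∑ (map g xs) f ≡ ∑[ x ∈ xs ] f (g x)
  ∑-map g []       f = refl
  ∑-map g (x ∷ xs) f = cong (f (g x) +_) (∑-map g xs f)

  ∑-zero : ∀ (xs : List A) → ∑[ x ∈ xs ] 0 ≡ 0
  ∑-zero []       = refl
  ∑-zero (x ∷ xs) = ∑-zero xs

  ∑-distrib-+ : ∀ xs (f g : A → ℕ) → ∑[ x ∈ xs ] (f x + g x) ≡ ∑ xs f + ∑ xs g
  ∑-distrib-+ []       f g = refl
  ∑-distrib-+ (x ∷ xs) f g =
    trans (cong (f x + g x +_) (∑-distrib-+ xs f g)) (interchange (f x) (g x) (∑ xs f) (∑ xs g))

  ∑-*ˡ : ∀ c xs (f : A → ℕ) → ∑[ x ∈ xs ] (c * f x) ≡ c * ∑ xs f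
  ∑-*ˡ c []       f = sym (*-zeroʳ c)
  ∑-*ˡ c (x ∷ xs) f = trans (cong (c * f x +_) (∑-*ˡ c xs f)) (sym (*-distribˡ-+ c (f x) _))

  ∑-monoᴬ : ∀ {P : A → Set} {f g : A → ℕ} {xs} → All P xs → (∀ {x} → P x → f x ≤ g x) → ∑ xs f ≤ ∑ xs g
  ∑-monoᴬ []         f≤g = z≤n
  ∑-monoᴬ (px ∷ pxs) f≤g = +-mono-≤ (f≤g px) (∑-monoᴬ pxs f≤g)

  ∑-mono : ∀ {f g : A → ℕ} xs → (∀ x → f x ≤ g x) → ∑ xs f ≤ ∑ xs g
  ∑-mono []       f≤g = z≤n
  ∑-mono (x ∷ xs) f≤g = +-mono-≤ (f≤g x) (∑-mono xs f≤g)

  ∑-comm : ∀ xs (ys : List B) (f : A → B → ℕ) →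
           ∑[ x ∈ xs ] ∑[ y ∈ ys ] f x y ≡ ∑[ y ∈ ys ] ∑[ x ∈ xs ] f x y
  ∑-comm []       ys f = sym (∑-zero ys)
  ∑-comm (x ∷ xs) ys f = trans (cong (∑[ y ∈ ys ] f x y +_) (∑-comm xs ys f))
                               (sym (∑-distrib-+ ys (f x) (λ y → ∑[ x ∈ xs ] f x y)))

  ∑-cartesianProductWith : ∀ (g : A → B → C) xs ys (f : C → ℕ) →
    ∑ (cartesianProductWith g xs ys) f ≡ ∑[ x ∈ xs ] ∑[ y ∈ ys ] f (g x y)
  ∑-cartesianProductWith g []       ys f = refl
  ∑-cartesianProductWith g (x ∷ xs) ys f =
    trans (∑-++ (map (g x) ys) _ f) (cong₂ _+_ (∑-map (g x) ys f) (∑-cartesianProductWith g xs ys f))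

  ∑-tabulate : ∀ {m} (g : Fin m → A) (f : A → ℕ) → ∑ (tabulate g) f ≡ ∑[ t ∈ allFin m ] f (g t)
  ∑-tabulate {m = zero}  g f = refl
  ∑-tabulate {m = suc m} g f = cong (f (g zero) +_)
    (trans (∑-tabulate (g ∘ suc) f) (sym (∑-tabulate suc (f ∘ g))))

  ∑-≤-capped : ∀ k (f : A → ℕ) (f≟ : ∀ x → Dec (f x ≡ suc k)) xs → All (λ x → f x ≤ suc k) xs →
               ∑ xs f ≤ k * length xs + length (filter f≟ xs)
  ∑-≤-capped k f f≟ []       []           = z≤n
  ∑-≤-capped k f f≟ (x ∷ xs) (fx≤ ∷ fxs≤) with f≟ x
  ... | yes fx≡ = ≤-trans (+-mono-≤ (≤-reflexive fx≡) (∑-≤-capped k f f≟ xs fxs≤))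
                          (≤-reflexive (regroup k (length xs) _))
    where
    regroup : ∀ k l c → suc k + (k * l + c) ≡ k * suc l + suc c
    regroup = solve-∀
  ... | no fx≢ = ≤-trans (+-mono-≤ (≤-pred (≤∧≢⇒< fx≤ fx≢)) (∑-≤-capped k f f≟ xs fxs≤))
                          (≤-reflexive (regroup k (length xs) _))
    where
    regroup : ∀ k l c → k + (k * l + c) ≡ k * suc l + c
    regroup = solve-∀

  ∑-allFin-interval : ∀ m lo hi (f : Fin m → ℕ) → hi ≤ m →
    (∀ t → lo ≤ toℕ t → toℕ t < hi → 1 ≤ f t) → hi ∸ lo ≤ ∑[ t ∈ allFin m ] f t
  ∑-allFin-interval m       lo       zero     f _ _ = ≤-trans (≤-reflexive (0∸n≡0 lo)) z≤n
  ∑-allFin-interval (suc m) zero     (suc hi) f (s≤s hi≤m) f≥1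
    rewrite ∑-tabulate suc f =
    +-mono-≤ (f≥1 zero z≤n (s≤s z≤n))
             (∑-allFin-interval m zero hi (f ∘ suc) hi≤m (λ t _ t<hi → f≥1 (suc t) z≤n (s≤s t<hi)))
  ∑-allFin-interval (suc m) (suc lo) (suc hi) f (s≤s hi≤m) f≥1
    rewrite ∑-tabulate suc f =
    ≤-trans (∑-allFin-interval m lo hi (f ∘ suc) hi≤m (λ t lo≤t t<hi → f≥1 (suc t) (s≤s lo≤t) (s≤s t<hi)))
            (m≤n+m _ (f zero))

module DoubleCounting {A : Set} (_≟_ : DecidableEquality A) where
  open import Data.Nat using (_+_; _≤_; z≤n; s≤s)
  open import Data.Nat.Properties using (≤-trans; ≤-reflexive; m≤m+n; m≤n+m; +-mono-≤; module ≤-Reasoning)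
  open import Data.List using ([]; _∷_)
  open import Data.List.Relation.Unary.Any using (here; there)
  open import Data.List.Relation.Unary.Unique.Propositional using (Unique)
  open import Data.List.Relation.Unary.AllPairs using ([]; _∷_)
  open import Data.List.Membership.DecPropositional _≟_ using (_∈?_)
  open import Data.Vec using (Vec; []; _∷_; count)
  open import Data.Vec.Relation.Unary.Any as Anyᵥ using ()
  open import Data.Vec.Membership.DecPropositional _≟_ using () renaming (_∈?_ to _∈ᵥ?_)
  open import Relation.Nullary using (yes; no; contradiction)
  open import Relation.Binary.PropositionalEquality
  open Sums

  χ-∈-∷-≤ : ∀ x v {m} (C : Vec A m) → χ (x ∈ᵥ? (v ∷ C)) ≤ χ (x ≟ v) + χ (x ∈ᵥ? C)
  χ-∈-∷-≤ x v C with x ∈ᵥ? (v ∷ C)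
  ... | yes (Anyᵥ.here x≡v)  = ≤-trans (χ-yes (x ≟ v) x≡v) (m≤m+n _ _)
  ... | yes (Anyᵥ.there x∈C) = ≤-trans (χ-yes (x ∈ᵥ? C) x∈C) (m≤n+m _ _)
  ... | no _                 = z≤n

  ∑-≟-≤-χ-∈ : ∀ {xs} → Unique xs → ∀ v → ∑[ x ∈ xs ] χ (x ≟ v) ≤ χ (v ∈? xs)
  ∑-≟-≤-χ-∈ {[]}     []           v = z≤n
  ∑-≟-≤-χ-∈ {y ∷ xs} (y∉xs ∷ xs!) v with y ≟ v
  ... | yes refl = ≤-trans (s≤s (≤-trans (∑-monoᴬ y∉xs χ-≢) (≤-reflexive (∑-zero xs))))
                           (χ-yes (v ∈? (y ∷ xs)) (here refl))
    where
    χ-≢ : ∀ {x} → v ≢ x → χ (x ≟ v) ≤ 0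
    χ-≢ {x} v≢x with x ≟ v
    ... | yes x≡v = contradiction (sym x≡v) v≢x
    ... | no _    = z≤n
  ... | no _ = ≤-trans (∑-≟-≤-χ-∈ xs! v) (χ-mono there (v ∈? xs) (v ∈? (y ∷ xs)))

  ∑-χ-∈-≤-count : ∀ {xs} → Unique xs → ∀ {m} (C : Vec A m) → ∑[ x ∈ xs ] χ (x ∈ᵥ? C) ≤ count (_∈? xs) C
  ∑-χ-∈-≤-count {xs} xs! []      = ≤-reflexive (∑-zero xs)
  ∑-χ-∈-≤-count {xs} xs! (v ∷ C) = begin
    ∑[ x ∈ xs ] χ (x ∈ᵥ? (v ∷ C))                ≤⟨ ∑-mono xs (λ x → χ-∈-∷-≤ x v C) ⟩
    ∑[ x ∈ xs ] (χ (x ≟ v) + χ (x ∈ᵥ? C))        ≡⟨ ∑-distrib-+ xs _ _ ⟩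
    ∑[ x ∈ xs ] χ (x ≟ v) + ∑[ x ∈ xs ] χ (x ∈ᵥ? C) ≤⟨ +-mono-≤ (∑-≟-≤-χ-∈ xs! v) (∑-χ-∈-≤-count xs! C) ⟩
    χ (v ∈? xs) + count (_∈? xs) C               ≡⟨ count-∷ (_∈? xs) v C ⟨
    count (_∈? xs) (v ∷ C)                       ∎
    where open ≤-Reasoning

module MaximalChains where
  open import Defs using (IsMaxChain)
  open import Data.Nat using (ℕ; zero; suc; _+_; _*_; _∸_; _≤_; _<_; z≤n; s≤s; _!)
  open import Data.Nat.Properties
  open import Data.Bool using (Bool)
  open import Data.Bool.Properties using () renaming (_≟_ to _≟ᵇ_)
  open import Data.Fin using (Fin; zero; suc; toℕ; inject₁)
  open import Data.Fin.Subset using (Subset; ∣_∣; _⊆_; inside; outside)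
  open import Data.Fin.Subset.Properties using (⊆-refl; out⊆; s⊆s; ∣p∣≤n)
  open import Data.Vec as Vec using (Vec; []; _∷_; lookup; map; head; count)
  open import Data.Vec.Properties using (≡-dec; ∷-injective; ∷-injectiveʳ)
  open import Data.Vec.Relation.Unary.Any using (here; there; any?)
  open import Data.Vec.Membership.Propositional using (_∈_)
  open import Data.Vec.Membership.Propositional.Properties using (∈-map⁺)
  open import Data.List as List using (List; length; cartesianProductWith; allFin)
  open import Data.List.Properties using (length-++; length-map; length-tabulate)
  open import Data.List.Relation.Unary.All as All using (All)
  import Data.List.Relation.Unary.All.Properties as All
  open import Data.List.Relation.Unary.Unique.Propositional using (Unique)
  open import Data.List.Relation.Unary.Unique.Propositional.Properties using (cartesianProductWith⁺; allFin⁺)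
  open import Data.List.Relation.Unary.AllPairs using ([]; _∷_)
  open import Data.Product using (_×_; _,_)
  open import Relation.Nullary using (Dec; yes; no; contradiction)
  open import Relation.Unary using (Decidable)
  open import Relation.Binary.PropositionalEquality
  open import Function using (_∘_; id)
  open import Algebra.Properties.CommutativeSemigroup *-commutativeSemigroup using (x∙yz≈y∙xz)
  open Sums

  data Chain {n : ℕ} : ℕ → {m : ℕ} → Vec (Subset n) (suc m) → Set where
    single : ∀ {a x} → ∣ x ∣ ≡ a → Chain a (x ∷ [])
    cons   : ∀ {a m x} {C : Vec (Subset n) (suc m)} → ∣ x ∣ ≡ a → x ⊆ head C → Chain (suc a) C → Chain a (x ∷ C)

  Chain⇒IsMaxChain : ∀ {n} {C : Vec (Subset n) (suc n)} → Chain 0 C → IsMaxChain n C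
  Chain⇒IsMaxChain ch = size ch , step ch
    where
    size : ∀ {n a m} {C : Vec (Subset n) (suc m)} → Chain a C → ∀ j → ∣ lookup C j ∣ ≡ a + toℕ j
    size {a = a} (single ∣x∣≡a)   zero    = trans ∣x∣≡a (sym (+-identityʳ a))
    size {a = a} (cons ∣x∣≡a _ _) zero    = trans ∣x∣≡a (sym (+-identityʳ a))
    size {a = a} (cons _ _ ch)    (suc j) = trans (size ch j) (sym (+-suc a (toℕ j)))
    step : ∀ {n a m} {C : Vec (Subset n) (suc m)} → Chain a C → ∀ j → lookup C (inject₁ j) ⊆ lookup C (suc j)
    step {C = _ ∷ _ ∷ _} (cons _ x⊆y _) zero    = x⊆y
    step {C = _ ∷ _ ∷ _} (cons _ _ ch)  (suc j) = step ch j

  -- extend C t is the chain of 2^[n+1] in which the new point 0 enters right after C_t: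
  -- outside ∷ C₀ ⊂ … ⊂ outside ∷ C_t ⊂ inside ∷ C_t ⊂ … ⊂ inside ∷ C_m.
  extend : ∀ {n m} → Vec (Subset n) (suc m) → Fin (suc m) → Vec (Subset (suc n)) (suc (suc m))
  extend (x ∷ xs)     zero    = (outside ∷ x) ∷ map (inside ∷_) (x ∷ xs)
  extend (x ∷ y ∷ ys) (suc t) = (outside ∷ x) ∷ extend (y ∷ ys) t

  maximalChains : ∀ n → List (Vec (Subset n) (suc n))
  maximalChains zero    = List.[ [] ∷ [] ]
  maximalChains (suc n) = cartesianProductWith extend (maximalChains n) (allFin (suc n))

  head-extend : ∀ {n m} (x : Subset n) (xs : Vec (Subset n) m) t → head (extend (x ∷ xs) t) ≡ outside ∷ x
  head-extend x xs       zero    = refl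
  head-extend x (y ∷ ys) (suc t) = refl

  Chain-map-inside : ∀ {n a m} {C : Vec (Subset n) (suc m)} → Chain a C → Chain (suc a) (map (inside ∷_) C)
  Chain-map-inside (single ∣x∣≡a)           = single (cong suc ∣x∣≡a)
  Chain-map-inside {C = _ ∷ _ ∷ _} (cons ∣x∣≡a x⊆y ch) = cons (cong suc ∣x∣≡a) (s⊆s x⊆y) (Chain-map-inside ch)

  Chain-extend : ∀ {n a m} {C : Vec (Subset n) (suc m)} → Chain a C → ∀ t → Chain a (extend C t)
  Chain-extend ch@(single ∣x∣≡a)   zero = cons ∣x∣≡a (out⊆ ⊆-refl) (Chain-map-inside ch)
  Chain-extend ch@(cons ∣x∣≡a _ _) zero = cons ∣x∣≡a (out⊆ ⊆-refl) (Chain-map-inside ch)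
  Chain-extend {C = x ∷ y ∷ ys} (cons ∣x∣≡a x⊆y ch) (suc t) =
    cons ∣x∣≡a (subst ((outside ∷ x) ⊆_) (sym (head-extend y ys t)) (out⊆ x⊆y)) (Chain-extend ch t)

  maximalChains-Chain : ∀ n → All (Chain 0) (maximalChains n)
  maximalChains-Chain zero    = single refl All.∷ All.[]
  maximalChains-Chain (suc n) = All.cartesianProductWith⁺ (setoid _) (setoid _) extend (maximalChains n) (allFin (suc n))
    (λ C∈ _ → Chain-extend (All.lookup (maximalChains-Chain n) C∈) _)

  map-injective : ∀ {A B : Set} {f : A → B} → (∀ {x y} → f x ≡ f y → x ≡ y) →
                  ∀ {m} {xs ys : Vec A m} → map f xs ≡ map f ys → xs ≡ ys
  map-injective f-inj {xs = []}     {[]}     _  = refl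
  map-injective f-inj {xs = x ∷ xs} {y ∷ ys} eq with ∷-injective eq
  ... | fx≡fy , eq′ = cong₂ _∷_ (f-inj fx≡fy) (map-injective f-inj eq′)

  extend-injective : ∀ {n m} {C D : Vec (Subset n) (suc m)} {t u : Fin (suc m)} →
                     extend C t ≡ extend D u → C ≡ D × t ≡ u
  extend-injective {C = _ ∷ _} {_ ∷ _} {zero} {zero} eq =
    map-injective ∷-injectiveʳ (∷-injectiveʳ eq) , refl
  extend-injective {C = _ ∷ _ ∷ _} {_ ∷ y ∷ ys} {zero} {suc u} eq
    with () ← trans (cong (head ∘ head ∘ Vec.tail) eq) (cong head (head-extend y ys u))
  extend-injective {C = _ ∷ x ∷ xs} {_ ∷ _ ∷ _} {suc t} {zero} eq
    with () ← trans (cong (head ∘ head ∘ Vec.tail) (sym eq)) (cong head (head-extend x xs t))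
  extend-injective {C = _ ∷ _ ∷ _} {_ ∷ _ ∷ _} {suc t} {suc u} eq
    with ∷-injective eq
  ... | x≡y , eq′ with extend-injective eq′
  ...   | C≡D , t≡u = cong₂ _∷_ (∷-injectiveʳ x≡y) C≡D , cong suc t≡u

  maximalChains-unique : ∀ n → Unique (maximalChains n)
  maximalChains-unique zero    = All.[] ∷ []
  maximalChains-unique (suc n) = cartesianProductWith⁺ extend extend-injective (maximalChains-unique n) (allFin⁺ (suc n))

  length-cartesianProductWith : ∀ {A B C : Set} (f : A → B → C) xs ys →
                                length (cartesianProductWith f xs ys) ≡ length xs * length ys
  length-cartesianProductWith f List.[]       ys = refl
  length-cartesianProductWith f (x List.∷ xs) ys =
    trans (length-++ (List.map (f x) ys)) (cong₂ _+_ (length-map (f x) ys) (length-cartesianProductWith f xs ys))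

  maximalChains-length : ∀ n → length (maximalChains n) ≡ n !
  maximalChains-length zero    = refl
  maximalChains-length (suc n) = begin
    length (maximalChains (suc n))          ≡⟨ length-cartesianProductWith extend (maximalChains n) (allFin (suc n)) ⟩
    length (maximalChains n) * length (allFin (suc n)) ≡⟨ cong₂ _*_ (maximalChains-length n) (length-tabulate id) ⟩
    n ! * suc n                             ≡⟨ *-comm (n !) (suc n) ⟩
    suc n !                                 ∎
    where open ≡-Reasoning

  _∈?_ : ∀ {n m} (S : Subset n) (C : Vec (Subset n) m) → Dec (S ∈ C)
  S ∈? C = any? (≡-dec _≟ᵇ_ S) C

  ∈-Chain⇒≤ : ∀ {n a m} {C : Vec (Subset n) (suc m)} {S} → Chain a C → S ∈ C → a ≤ ∣ S ∣
  ∈-Chain⇒≤ (single ∣x∣≡a)   (here refl)  = ≤-reflexive (sym ∣x∣≡a)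
  ∈-Chain⇒≤ (cons ∣x∣≡a _ _) (here refl)  = ≤-reflexive (sym ∣x∣≡a)
  ∈-Chain⇒≤ (cons _ _ ch)    (there S∈C) = ≤-trans (n≤1+n _) (∈-Chain⇒≤ ch S∈C)

  outside∷-∈-extend : ∀ {n a m} {C : Vec (Subset n) (suc m)} {S} → Chain a C → S ∈ C →
                      ∀ t → ∣ S ∣ ≤ a + toℕ t → (outside ∷ S) ∈ extend C t
  outside∷-∈-extend (single _)  (here refl) zero    _ = here refl
  outside∷-∈-extend (cons _ _ _) (here refl) zero    _ = here refl
  outside∷-∈-extend {a = a} (cons _ _ ch) (there S∈C) zero ∣S∣≤a =
    contradiction (≤-trans (∈-Chain⇒≤ ch S∈C) (≤-trans ∣S∣≤a (≤-reflexive (+-identityʳ a)))) (n≮n a)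
  outside∷-∈-extend {C = _ ∷ _ ∷ _} (cons _ _ _) (here refl) (suc t) _ = here refl
  outside∷-∈-extend {a = a} {C = _ ∷ _ ∷ _} (cons _ _ ch) (there S∈C) (suc t) ∣S∣≤ =
    there (outside∷-∈-extend ch S∈C t (≤-trans ∣S∣≤ (≤-reflexive (+-suc a (toℕ t)))))

  inside∷-∈-extend : ∀ {n a m} {C : Vec (Subset n) (suc m)} {S} → Chain a C → S ∈ C →
                     ∀ t → a + toℕ t ≤ ∣ S ∣ → (inside ∷ S) ∈ extend C t
  inside∷-∈-extend {C = _ ∷ _} _ S∈C zero _ = there (∈-map⁺ (inside ∷_) S∈C)
  inside∷-∈-extend {a = a} {C = _ ∷ _ ∷ _} (cons ∣x∣≡a _ _) (here refl) (suc t) ≤∣S∣ =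
    contradiction (≤-trans (≤-trans (m≤m+n (suc a) (toℕ t)) (≤-trans (≤-reflexive (sym (+-suc a (toℕ t)))) ≤∣S∣))
                           (≤-reflexive ∣x∣≡a)) (n≮n a)
  inside∷-∈-extend {a = a} {C = _ ∷ _ ∷ _} (cons _ _ ch) (there S∈C) (suc t) ≤∣S∣ =
    there (inside∷-∈-extend ch S∈C t (≤-trans (≤-reflexive (sym (+-suc a (toℕ t)))) ≤∣S∣))

  chainsThrough : ℕ → ℕ → ℕ
  chainsThrough n s = s ! * (n ∸ s) !

  -- the number of t for which extend C t passes through b ∷ S, when S lies on C
  positions : Bool → ℕ → ℕ → ℕ
  positions outside n s = suc n ∸ s
  positions inside  n s = suc s

  chainsThrough-suc : ∀ {n} b (S : Subset n) → chainsThrough (suc n) ∣ b ∷ S ∣ ≡ positions b n ∣ S ∣ * chainsThrough n ∣ S ∣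
  chainsThrough-suc {n} outside S = begin
    ∣ S ∣ ! * (suc n ∸ ∣ S ∣) !             ≡⟨ cong (λ d → ∣ S ∣ ! * d !) (+-∸-assoc 1 (∣p∣≤n S)) ⟩
    ∣ S ∣ ! * (suc (n ∸ ∣ S ∣) * (n ∸ ∣ S ∣) !) ≡⟨ x∙yz≈y∙xz (∣ S ∣ !) (suc (n ∸ ∣ S ∣)) _ ⟩
    suc (n ∸ ∣ S ∣) * chainsThrough n ∣ S ∣ ≡⟨ cong (_* chainsThrough n ∣ S ∣) (+-∸-assoc 1 (∣p∣≤n S)) ⟨
    positions outside n ∣ S ∣ * chainsThrough n ∣ S ∣ ∎
    where open ≡-Reasoning
  chainsThrough-suc {n} inside S = *-assoc (suc ∣ S ∣) (∣ S ∣ !) ((n ∸ ∣ S ∣) !)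

  positions-≤ : ∀ {n} {C : Vec (Subset n) (suc n)} → Chain 0 C → ∀ b {S} → S ∈ C →
                positions b n ∣ S ∣ ≤ ∑[ t ∈ allFin (suc n) ] χ ((b ∷ S) ∈? extend C t)
  positions-≤ {n} {C} ch outside {S} S∈C =
    ∑-allFin-interval (suc n) ∣ S ∣ (suc n) _ ≤-refl
      (λ t ∣S∣≤t _ → χ-yes ((outside ∷ S) ∈? extend C t) (outside∷-∈-extend ch S∈C t ∣S∣≤t))
  positions-≤ {n} {C} ch inside {S} S∈C =
    ∑-allFin-interval (suc n) 0 (suc ∣ S ∣) _ (s≤s (∣p∣≤n S))
      (λ t _ t≤∣S∣ → χ-yes ((inside ∷ S) ∈? extend C t) (inside∷-∈-extend ch S∈C t (≤-pred t≤∣S∣)))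

  chainsThrough-≤ : ∀ n (S : Subset n) → chainsThrough n ∣ S ∣ ≤ ∑[ C ∈ maximalChains n ] χ (S ∈? C)
  chainsThrough-≤ zero    [] = ≤-refl
  chainsThrough-≤ (suc n) (b ∷ S) = begin
    chainsThrough (suc n) ∣ b ∷ S ∣                      ≡⟨ chainsThrough-suc b S ⟩
    p * chainsThrough n ∣ S ∣                            ≤⟨ *-monoʳ-≤ p (chainsThrough-≤ n S) ⟩
    p * ∑[ C ∈ maximalChains n ] χ (S ∈? C)              ≡⟨ ∑-*ˡ p (maximalChains n) _ ⟨
    ∑[ C ∈ maximalChains n ] (p * χ (S ∈? C))            ≤⟨ ∑-monoᴬ (maximalChains-Chain n) (λ {C} ch → through C ch) ⟩
    ∑[ C ∈ maximalChains n ] ∑[ t ∈ allFin (suc n) ] χ ((b ∷ S) ∈? extend C t)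
                                                         ≡⟨ ∑-cartesianProductWith extend (maximalChains n) (allFin (suc n)) _ ⟨
    ∑[ C ∈ maximalChains (suc n) ] χ ((b ∷ S) ∈? C)      ∎
    where
    open ≤-Reasoning
    p = positions b n ∣ S ∣
    through : ∀ C → Chain 0 C → p * χ (S ∈? C) ≤ ∑[ t ∈ allFin (suc n) ] χ ((b ∷ S) ∈? extend C t)
    through C ch with S ∈? C
    ... | yes S∈C = ≤-trans (≤-reflexive (*-identityʳ p)) (positions-≤ ch b S∈C)
    ... | no _    = ≤-trans (≤-reflexive (*-zeroʳ p)) z≤n

  module _ {n} {P : Subset n → Set} (P? : Decidable P) where

    count-Chain-≤-∸ : ∀ {a m hi} {C : Vec (Subset n) (suc m)} → Chain a C →
                      (∀ {S} → P S → ∣ S ∣ < hi) → count P? C ≤ hi ∸ a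
    count-Chain-≤-∸ {C = x ∷ _} (single ∣x∣≡a) <hi with P? x
    ... | yes Px = m<n⇒0<n∸m (subst (_< _) ∣x∣≡a (<hi Px))
    ... | no _   = z≤n
    count-Chain-≤-∸ {a} {hi = hi} {x ∷ _} (cons ∣x∣≡a _ ch) <hi with P? x
    ... | yes Px = ≤-trans (s≤s (count-Chain-≤-∸ ch <hi))
                           (≤-reflexive (sym (+-∸-assoc 1 (subst (_< hi) ∣x∣≡a (<hi Px)))))
    ... | no _   = ≤-trans (count-Chain-≤-∸ ch <hi) (∸-monoʳ-≤ hi (n≤1+n a))

    count-Chain-≤-width : ∀ k {a m} {C : Vec (Subset n) (suc m)} → Chain a C →
                          (∀ {S T} → P S → P T → ∣ T ∣ < ∣ S ∣ + suc k) → count P? C ≤ suc k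
    count-Chain-≤-width k {C = x ∷ _} (single _) width with P? x
    ... | yes _ = s≤s z≤n
    ... | no _  = z≤n
    count-Chain-≤-width k {a} {C = x ∷ _} (cons ∣x∣≡a _ ch) width with P? x
    ... | yes Px = s≤s (≤-trans (count-Chain-≤-∸ ch (λ PT → subst (λ s → _ < s + suc k) ∣x∣≡a (width Px PT)))
                                (≤-reflexive (trans (cong (_∸ suc a) (+-suc a k)) (m+n∸m≡n a k))))
    ... | no _   = count-Chain-≤-width k ch width

module ChainCounting where
  open import Defs using (membersOn)
  open import Data.Nat using (suc; _+_; _*_; _≤_; _<_; _≟_; _!)
  open import Data.Nat.Properties using (module ≤-Reasoning)
  open import Data.Bool.Properties using () renaming (_≟_ to _≟ᵇ_)
  open import Data.Fin.Subset using (Subset; ∣_∣)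
  open import Data.Vec.Properties using (≡-dec)
  open import Data.List using (List; length; filter)
  open import Data.List.Membership.Propositional using (_∈_)
  import Data.List.Relation.Unary.All as All
  open import Data.List.Relation.Unary.Unique.Propositional using (Unique)
  open import Relation.Binary.PropositionalEquality using (cong)
  open Sums
  open MaximalChains

  ∑-chainsThrough-≤ : ∀ n k (𝓕 : List (Subset n)) → Unique 𝓕 →
    (∀ {S T} → S ∈ 𝓕 → T ∈ 𝓕 → ∣ T ∣ < ∣ S ∣ + suc k) →
    ∑[ F ∈ 𝓕 ] chainsThrough n ∣ F ∣ ≤ k * n ! + length (filter (λ C → membersOn 𝓕 C ≟ suc k) (maximalChains n))
  ∑-chainsThrough-≤ n k 𝓕 𝓕! width = begin
    ∑[ F ∈ 𝓕 ] chainsThrough n ∣ F ∣                 ≤⟨ ∑-mono 𝓕 (chainsThrough-≤ n) ⟩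
    ∑[ F ∈ 𝓕 ] ∑[ C ∈ Cs ] χ (F ∈? C)                ≡⟨ ∑-comm 𝓕 Cs (λ F C → χ (F ∈? C)) ⟩
    ∑[ C ∈ Cs ] ∑[ F ∈ 𝓕 ] χ (F ∈? C)                ≤⟨ ∑-mono Cs (∑-χ-∈-≤-count 𝓕!) ⟩
    ∑[ C ∈ Cs ] membersOn 𝓕 C                         ≤⟨ ∑-≤-capped k (membersOn 𝓕) (λ C → membersOn 𝓕 C ≟ suc k) Cs
                                                           (All.map (λ ch → count-Chain-≤-width (_∈?ₗ 𝓕) k ch width) (maximalChains-Chain n)) ⟩
    k * length Cs + length Cₖ                         ≡⟨ cong (λ l → k * l + length Cₖ) (maximalChains-length n) ⟩
    k * n ! + length Cₖ                               ∎
    where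
    open ≤-Reasoning
    open DoubleCounting (≡-dec {n = n} _≟ᵇ_) using (∑-χ-∈-≤-count)
    open import Data.List.Membership.DecPropositional (≡-dec {n = n} _≟ᵇ_) using () renaming (_∈?_ to _∈?ₗ_)
    Cs = maximalChains n
    Cₖ = filter (λ C → membersOn 𝓕 C ≟ suc k) Cs

module RationalBounds where
  open import Defs using (ℕ→ℚ; inv; lubell)
  open import Data.Nat as ℕ using (zero; suc; _!)
  import Data.Nat.Properties as ℕ
  open import Data.Nat.Combinatorics using (_C_; nCk≡n!/k![n-k]!; k![n∸k]!∣n!)
  open import Data.Nat.Coprimality using (1-coprimeTo) renaming (sym to coprime-sym)
  open import Data.Nat.DivMod using (m/n*n≡m)
  open import Data.Integer as ℤ using (+_)
  import Data.Integer.Properties as ℤ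
  open import Data.Rational using (_/_; _≤_; _+_; _*_; -_; 0ℚ; 1ℚ; mkℚ; NonNegative; nonNegative; *≤*)
  open import Data.Rational.Properties
  open import Data.Fin.Subset using (Subset; ∣_∣)
  open import Data.Fin.Subset.Properties using (∣p∣≤n)
  open import Data.List using (List; []; _∷_)
  open import Data.Sum using (inj₁; inj₂)
  open import Relation.Nullary using (contradiction)
  open import Relation.Binary.PropositionalEquality
  open Sums using (∑)
  open MaximalChains using (chainsThrough)

  ℕ→ℚ≡mkℚ : ∀ m → ℕ→ℚ m ≡ mkℚ (+ m) 0 (coprime-sym (1-coprimeTo m))
  ℕ→ℚ≡mkℚ m = normalize-coprime (coprime-sym (1-coprimeTo m))

  ℕ→ℚ-+ : ∀ a b → ℕ→ℚ (a ℕ.+ b) ≡ ℕ→ℚ a + ℕ→ℚ b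
  ℕ→ℚ-+ a b rewrite ℕ→ℚ≡mkℚ a | ℕ→ℚ≡mkℚ b =
    cong₂ (λ x y → (x ℤ.+ y) / 1) (sym (ℤ.*-identityʳ (+ a))) (sym (ℤ.*-identityʳ (+ b)))

  ℕ→ℚ-* : ∀ a b → ℕ→ℚ (a ℕ.* b) ≡ ℕ→ℚ a * ℕ→ℚ b
  ℕ→ℚ-* a b rewrite ℕ→ℚ≡mkℚ a | ℕ→ℚ≡mkℚ b = cong (_/ 1) (ℤ.pos-* a b)

  ℕ→ℚ-mono-≤ : ∀ {a b} → a ℕ.≤ b → ℕ→ℚ a ≤ ℕ→ℚ b
  ℕ→ℚ-mono-≤ {a} {b} a≤b rewrite ℕ→ℚ≡mkℚ a | ℕ→ℚ≡mkℚ b =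
    *≤* (subst₂ ℤ._≤_ (sym (ℤ.*-identityʳ (+ a))) (sym (ℤ.*-identityʳ (+ b))) (ℤ.+≤+ a≤b))

  ℕ→ℚ-nonNeg : ∀ m → NonNegative (ℕ→ℚ m)
  ℕ→ℚ-nonNeg m = normalize-nonNeg m 1

  inv-suc≡mkℚ : ∀ m → inv (suc m) ≡ mkℚ (+ 1) m (1-coprimeTo (suc m))
  inv-suc≡mkℚ m = normalize-coprime (1-coprimeTo (suc m))

  inv-suc-nonNeg : ∀ m → NonNegative (inv (suc m))
  inv-suc-nonNeg m = normalize-nonNeg 1 (suc m)

  inv-suc≤1 : ∀ m → inv (suc m) ≤ 1ℚ
  inv-suc≤1 m rewrite inv-suc≡mkℚ m = *≤* (ℤ.+≤+ (ℕ.s≤s ℕ.z≤n))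

  inv-suc-*-ℕ→ℚ : ∀ m → inv (suc m) * ℕ→ℚ (suc m) ≡ 1ℚ
  inv-suc-*-ℕ→ℚ m rewrite inv-suc≡mkℚ m | ℕ→ℚ≡mkℚ (suc m) =
    *-inverseˡ (mkℚ (+ suc m) 0 (coprime-sym (1-coprimeTo (suc m))))

  inv-*-ℕ→ℚ-cancel : ∀ c d {N} → 0 ℕ.< N → c ℕ.* d ≡ N → inv c * ℕ→ℚ N ≡ ℕ→ℚ d
  inv-*-ℕ→ℚ-cancel zero    d 0<N refl = contradiction 0<N (ℕ.n≮n 0)
  inv-*-ℕ→ℚ-cancel (suc c) d 0<N refl = begin
    inv (suc c) * ℕ→ℚ (suc c ℕ.* d)         ≡⟨ cong (inv (suc c) *_) (ℕ→ℚ-* (suc c) d) ⟩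
    inv (suc c) * (ℕ→ℚ (suc c) * ℕ→ℚ d)     ≡⟨ *-assoc (inv (suc c)) _ _ ⟨
    (inv (suc c) * ℕ→ℚ (suc c)) * ℕ→ℚ d     ≡⟨ cong (_* ℕ→ℚ d) (inv-suc-*-ℕ→ℚ c) ⟩
    1ℚ * ℕ→ℚ d                              ≡⟨ *-identityˡ _ ⟩
    ℕ→ℚ d                                   ∎
    where open ≡-Reasoning

  inv-binomial-*-n! : ∀ n s → s ℕ.≤ n → inv (n C s) * ℕ→ℚ (n !) ≡ ℕ→ℚ (chainsThrough n s)
  inv-binomial-*-n! n s s≤n = inv-*-ℕ→ℚ-cancel (n C s) (chainsThrough n s) (ℕ.1≤n! n)
    (trans (cong (ℕ._* chainsThrough n s) (nCk≡n!/k![n-k]! s≤n))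
           (m/n*n≡m {{ℕ._!*_!≢0 s (n ℕ.∸ s)}} (k![n∸k]!∣n! s≤n)))

  lubell-*-n! : ∀ n (𝓕 : List (Subset n)) → lubell n 𝓕 * ℕ→ℚ (n !) ≡ ℕ→ℚ (∑[ F ∈ 𝓕 ] chainsThrough n ∣ F ∣)
  lubell-*-n! n []      = *-zeroˡ (ℕ→ℚ (n !))
  lubell-*-n! n (S ∷ 𝓕) = begin
    (inv (n C ∣ S ∣) + lubell n 𝓕) * ℕ→ℚ (n !)                     ≡⟨ *-distribʳ-+ (ℕ→ℚ (n !)) (inv (n C ∣ S ∣)) _ ⟩
    inv (n C ∣ S ∣) * ℕ→ℚ (n !) + lubell n 𝓕 * ℕ→ℚ (n !)           ≡⟨ cong₂ _+_ (inv-binomial-*-n! n ∣ S ∣ (∣p∣≤n S)) (lubell-*-n! n 𝓕) ⟩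
    ℕ→ℚ (chainsThrough n ∣ S ∣) + ℕ→ℚ (∑[ F ∈ 𝓕 ] chainsThrough n ∣ F ∣) ≡⟨ ℕ→ℚ-+ (chainsThrough n ∣ S ∣) _ ⟨
    ℕ→ℚ (∑[ F ∈ S ∷ 𝓕 ] chainsThrough n ∣ F ∣)                       ∎
    where open ≡-Reasoning

  +-cancelˡ-≤ : ∀ x {y z} → x + y ≤ x + z → y ≤ z
  +-cancelˡ-≤ x {y} {z} x+y≤x+z = subst₂ _≤_ (-x+[x+w]≡w y) (-x+[x+w]≡w z) (+-monoʳ-≤ (- x) x+y≤x+z)
    where
    -x+[x+w]≡w : ∀ w → - x + (x + w) ≡ w
    -x+[x+w]≡w w = trans (sym (+-assoc (- x) x w)) (trans (cong (_+ w) (+-inverseˡ x)) (+-identityˡ w))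

  excess-≤ : ∀ k ε L N a → ℕ→ℚ k + ε ≤ L → L * ℕ→ℚ N ≤ ℕ→ℚ (k ℕ.* N ℕ.+ a) → ε * ℕ→ℚ N ≤ ℕ→ℚ a
  excess-≤ k ε L N a k+ε≤L LN≤ = +-cancelˡ-≤ (ℕ→ℚ k * ℕ→ℚ N) (begin
    ℕ→ℚ k * ℕ→ℚ N + ε * ℕ→ℚ N    ≡⟨ *-distribʳ-+ (ℕ→ℚ N) (ℕ→ℚ k) ε ⟨
    (ℕ→ℚ k + ε) * ℕ→ℚ N          ≤⟨ *-monoʳ-≤-nonNeg (ℕ→ℚ N) {{ℕ→ℚ-nonNeg N}} k+ε≤L ⟩
    L * ℕ→ℚ N                    ≤⟨ LN≤ ⟩
    ℕ→ℚ (k ℕ.* N ℕ.+ a)          ≡⟨ trans (ℕ→ℚ-+ (k ℕ.* N) a) (cong (_+ ℕ→ℚ a) (ℕ→ℚ-* k N)) ⟩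
    ℕ→ℚ k * ℕ→ℚ N + ℕ→ℚ a        ∎)
    where open ≤-Reasoning

  *-inv-suc-≤ : ∀ k ε N a → ε * ℕ→ℚ N ≤ ℕ→ℚ a → (ε * inv (suc k)) * ℕ→ℚ N ≤ ℕ→ℚ a
  *-inv-suc-≤ k ε N a εN≤a with ≤-total 0ℚ ε
  ... | inj₁ 0≤ε = ≤-trans (*-monoʳ-≤-nonNeg (ℕ→ℚ N) {{ℕ→ℚ-nonNeg N}} ε/k≤ε) εN≤a
    where
    ε/k≤ε : ε * inv (suc k) ≤ ε
    ε/k≤ε = subst (ε * inv (suc k) ≤_) (*-identityʳ ε) (*-monoˡ-≤-nonNeg ε {{nonNegative 0≤ε}} (inv-suc≤1 k))
  ... | inj₂ ε≤0 = ≤-trans ε/k·N≤0 (nonNegative⁻¹ (ℕ→ℚ a) {{ℕ→ℚ-nonNeg a}})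
    where
    ε/k≤0 : ε * inv (suc k) ≤ 0ℚ
    ε/k≤0 = subst (ε * inv (suc k) ≤_) (*-zeroˡ (inv (suc k))) (*-monoʳ-≤-nonNeg (inv (suc k)) {{inv-suc-nonNeg k}} ε≤0)
    ε/k·N≤0 : (ε * inv (suc k)) * ℕ→ℚ N ≤ 0ℚ
    ε/k·N≤0 = subst ((ε * inv (suc k)) * ℕ→ℚ N ≤_) (*-zeroˡ (ℕ→ℚ N)) (*-monoʳ-≤-nonNeg (ℕ→ℚ N) {{ℕ→ℚ-nonNeg N}} ε/k≤0)

open import Defs
open import Data.Nat using (ℕ; suc; _≥_; _∸_; _!)
open import Data.Integer using (ℤ; +_) renaming (_≤_ to _≤ℤ_; _<_ to _<ℤ_; _+_ to _+ℤ_)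
open import Data.Rational using (ℚ; _≤_; _+_; _*_)
open import Data.Fin.Subset using (Subset; ∣_∣)
open import Data.Vec using (Vec)
open import Data.List using (List; length)
open import Data.List.Relation.Unary.All using (All)
open import Data.List.Relation.Unary.Unique.Propositional using (Unique)
open import Data.Product using (Σ; _×_)
open import Relation.Binary.PropositionalEquality using (_≡_)

import Data.Nat as ℕ
import Data.Integer.Properties as ℤ
open import Data.Integer using (+<+)
open import Data.List using (filter)
import Data.List.Relation.Unary.All as All
open import Data.List.Relation.Unary.All.Properties using (all-filter; filter⁺)
open import Data.List.Relation.Unary.Unique.Propositional.Properties using () renaming (filter⁺ to Unique-filter⁺)
open import Data.Product using (_,_)
open import Data.List.Membership.Propositional using (_∈_)
open import Relation.Binary.PropositionalEquality using (subst; sym)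
open MaximalChains using (maximalChains; maximalChains-unique; maximalChains-Chain; Chain⇒IsMaxChain)
open ChainCounting using (∑-chainsThrough-≤)
open RationalBounds using (lubell-*-n!; excess-≤; *-inv-suc-≤; ℕ→ℚ-mono-≤)

lemma2p3 : (k n : ℕ) (i : ℤ) (ε : ℚ) → k ≥ 1 → n ≥ 1 →
    (𝓕 : List (Subset n)) → Unique 𝓕 →
    All (λ S → (i ≤ℤ + ∣ S ∣) × (+ ∣ S ∣ <ℤ i +ℤ + k)) 𝓕 →
    ℕ→ℚ (k ∸ 1) + ε ≤ lubell n 𝓕 →
    Σ (List (Vec (Subset n) (suc n))) λ Cs →
      Unique Cs ×
      All (λ C → IsMaxChain n C × membersOn 𝓕 C ≡ k) Cs ×
      (ε * inv k) * ℕ→ℚ (n !) ≤ ℕ→ℚ (length Cs)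
lemma2p3 (suc k) n i ε _ _ 𝓕 𝓕! sizes k+ε≤lubell =
  Cs , Unique-filter⁺ full? (maximalChains-unique n) ,
  All.zip (filter⁺ full? (All.map Chain⇒IsMaxChain (maximalChains-Chain n)) , all-filter full? (maximalChains n)) ,
  *-inv-suc-≤ k ε (n !) (length Cs)
    (excess-≤ k ε (lubell n 𝓕) (n !) (length Cs) k+ε≤lubell lubell·n!≤)
  where
  full? = λ C → membersOn 𝓕 C ℕ.≟ suc k
  Cs = filter full? (maximalChains n)
  width : ∀ {S T} → S ∈ 𝓕 → T ∈ 𝓕 → ∣ T ∣ ℕ.< ∣ S ∣ ℕ.+ suc k
  width S∈𝓕 T∈𝓕 with All.lookup sizes S∈𝓕 | All.lookup sizes T∈𝓕
  ... | i≤∣S∣ , _ | _ , ∣T∣<i+k with ℤ.<-≤-trans ∣T∣<i+k (ℤ.+-monoˡ-≤ (+ suc k) i≤∣S∣)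
  ...   | +<+ ∣T∣<∣S∣+k = ∣T∣<∣S∣+k
  lubell·n!≤ : lubell n 𝓕 * ℕ→ℚ (n !) ≤ ℕ→ℚ (k ℕ.* n ! ℕ.+ length Cs)
  lubell·n!≤ = subst (_≤ ℕ→ℚ (k ℕ.* n ! ℕ.+ length Cs)) (sym (lubell-*-n! n 𝓕)) (ℕ→ℚ-mono-≤ (∑-chainsThrough-≤ n k 𝓕 𝓕! width))
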